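{- Let $k\ge1$, $\lambda\in\mathcal P^k$, $1\le t\le k$, and let $r\in\mathbb Z_{\ge0}$ be such that $\lambda_r\ge t\ge\lambda_{r+1}$ (with the convention $\lambda_0=\infty$). Put $\tilde\lambda=\lambda\cup R_t$. Then for all $i\ge1$, $$\mathfrak c(\tilde\lambda)_i=\begin{cases}\mathfrak c(\lambda)_i+t & \text{if } i\le r+(k+1-t),\\ \mathfrak c(\lambda)_{i-(k+1-t)} & \text{if } i\ge (r+1)+(k+1-t).\end{cases}$$
   Context: Partitions are identified with Young diagrams in French notation (cells $(i,j)$ with $j\le\lambda_i$, row $i$ from the bottom), and $\lambda_i=0$ for $i>l(\lambda)$; $\lambda'$ is the conjugate; $\lambda\cup\mu$ is the partition whose multiset of parts is the union of those of $\lambda$ and $\mu$. $\mathcal P^k$ is the set of partitions with $\lambda_1\le k$. For $1\le t\le k$, $R_t=(t^{k+1-t})$. The hook length of $c=(i,j)\in\lambda$ is $\lambda_i+\lambda'_j-i-j+1$. A $(k+1)$-core is a partition with no cell of hook length $k+1$. The map $\mathfrak p(\kappa)_i=\#\{j:(i,j)\in\kappa,\ \text{hook length of }(i,j)\le k\}$ is a bijection from $(k+1)$-cores to $\mathcal P^k$; its inverse is $\mathfrak c$. -}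

module Defs where

open import Data.Nat using (ℕ; zero; suc; _+_; _∸_; _≤_; _<_; _≤?_; _≥_)
open import Data.List using (List; []; _∷_; length; filter; replicate; foldr)
open import Data.List.Relation.Unary.All using (All)
open import Data.List.Relation.Unary.Linked using (Linked)
open import Data.Product using (_×_)
open import Relation.Binary.PropositionalEquality using (_≡_)
open import Relation.Nullary using (¬_)

IsPartition : List ℕ → Set
IsPartition xs = Linked _≥_ xs × All (0 <_) xs

Bounded : ℕ → List ℕ → Set
Bounded k xs = All (_≤ k) xs

-- i-th part, 1-indexed, with λ_i = 0 for i > l(λ).  (part xs 0 = 0 is never used.)
part : List ℕ → ℕ → ℕ
part []       _             = 0
part (x ∷ xs) zero          = 0
part (x ∷ xs) (suc zero)    = x
part (x ∷ xs) (suc (suc i)) = part xs (suc i)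

conj : List ℕ → ℕ → ℕ
conj xs j = length (filter (j ≤?_) xs)

hook : List ℕ → ℕ → ℕ → ℕ
hook xs i j = (part xs i + conj xs j + 1) ∸ (i + j)

Cell : List ℕ → ℕ → ℕ → Set
Cell xs i j = 1 ≤ i × 1 ≤ j × j ≤ part xs i

IsCore : ℕ → List ℕ → Set
IsCore k κ = IsPartition κ × (∀ i j → Cell κ i j → ¬ (hook κ i j ≡ suc k))

countRow : ℕ → List ℕ → ℕ → ℕ → ℕ
countRow k κ i zero    = 0
countRow k κ i (suc n) with hook κ i (suc n) ≤? k
... | Relation.Nullary.yes _ = suc (countRow k κ i n)
... | Relation.Nullary.no  _ = countRow k κ i n

pmap : ℕ → List ℕ → ℕ → ℕ
pmap k κ i = countRow k κ i (part κ i)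

ins : ℕ → List ℕ → List ℕ
ins t []       = t ∷ []
ins t (x ∷ xs) with t ≤? x
... | Relation.Nullary.yes _ = x ∷ ins t xs
... | Relation.Nullary.no  _ = t ∷ x ∷ xs

union : List ℕ → List ℕ → List ℕ
union la mu = foldr ins la mu

R : ℕ → ℕ → List ℕ
R k t = replicate (suc k ∸ t) t

-- κ = 𝔠(λ), i.e. κ is a (k+1)-core with 𝔭(κ) = λ (compared part by part)
IsCoreOf : ℕ → List ℕ → List ℕ → Set
IsCoreOf k κ la = IsCore k κ × (∀ i → 1 ≤ i → pmap k κ i ≡ part la i)

-- In a diagram without hooks k + 1, "row i has exactly ℓ cells of hook ≤ k" can be
-- read off from the length of row i and its leg counts (how many rows below i reach
-- a given column): this is 'RowCondition'. As leg counts decrease with the column,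
-- the condition determines the length of row i from ℓ and the rows below it, so a
-- core is determined by its 𝔭-values, row by row from the bottom ('rows-determine').
-- It therefore suffices to check that the candidate diagram satisfies the row
-- conditions for the parts of λ ∪ R_t; this is done separately for the rows above r,
-- the inserted band r < i ≤ r + K and the rows below it ('ShiftedCore'). The key input
-- is that below row r, where λ ≤ t, the rows of a core drop by at most t within K
-- steps ('close').
module Submission where

open import Defs
open import Data.Nat using (ℕ; suc; _+_; _∸_; _≤_)
open import Data.List using (List)
open import Data.Product using (_×_)
open import Data.Sum using (_⊎_)
open import Relation.Binary.PropositionalEquality using (_≡_)

open import Data.Nat using (zero; pred; _<_; _≥_; z≤n; s≤s; s≤s⁻¹; _≤?_; _≟_)
open import Data.Nat.Properties
open import Data.Nat.Tactic.RingSolver using (solve-∀)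
open import Data.List using ([]; _∷_; length; replicate)
open import Data.List.Properties using (filter-accept; filter-reject)
open import Data.List.Relation.Unary.Linked using (Linked; _∷_)
open import Data.Product using (_,_; proj₁; proj₂)
open import Data.Sum using (inj₁; inj₂)
open import Data.Empty using (⊥-elim)
open import Relation.Nullary using (yes; no)
open import Relation.Binary.Definitions using (tri<; tri≈; tri>)
open import Relation.Binary.PropositionalEquality
  using (refl; sym; trans; cong; cong₂; subst; subst₂; module ≡-Reasoning)

-- A diagram is handled through its row-length function g (row b has g b cells).
-- The leg of a cell (i , j) is the number of rows below row i reaching column j,
-- so everything about hooks reduces to the counting function 'count' below.

ind : ℕ → ℕ → ℕ
ind zero    x       = 1
ind (suc j) zero    = 0
ind (suc j) (suc x) = ind j x

ind-yes : ∀ {j x} → j ≤ x → ind j x ≡ 1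
ind-yes {zero}          _       = refl
ind-yes {suc j} {suc x} (s≤s p) = ind-yes p

ind-no : ∀ {j x} → x < j → ind j x ≡ 0
ind-no {suc j} {zero}  _       = refl
ind-no {suc j} {suc x} (s≤s p) = ind-no p

ind-≤1 : ∀ j x → ind j x ≤ 1
ind-≤1 zero    x       = ≤-refl
ind-≤1 (suc j) zero    = z≤n
ind-≤1 (suc j) (suc x) = ind-≤1 j x

ind-anti : ∀ {j j'} x → j ≤ j' → ind j' x ≤ ind j x
ind-anti {j' = zero}      x       z≤n     = ≤-refl
ind-anti {zero} {suc j'}  x       _       = ind-≤1 (suc j') x
ind-anti {suc j} {suc j'} zero    _       = z≤n
ind-anti {suc j} {suc j'} (suc x) (s≤s p) = ind-anti x p

ind-shift : ∀ j x t → ind (j + t) (x + t) ≡ ind j x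
ind-shift j x zero    = cong₂ ind (+-identityʳ j) (+-identityʳ x)
ind-shift j x (suc t) = trans (cong₂ ind (+-suc j t) (+-suc x t)) (ind-shift j x t)

Within : ℕ → (ℕ → Set) → Set
Within n P = ∀ d → 1 ≤ d → d ≤ n → P d

within-head : ∀ {n P} → Within (suc n) P → P 1
within-head H = H 1 ≤-refl (s≤s z≤n)

within-tail : ∀ {n P} → Within (suc n) P → Within n (λ d → P (suc d))
within-tail H d _ d≤n = H (suc d) (s≤s z≤n) (s≤s d≤n)

row-head : ∀ {n} P a → Within (suc n) (λ d → P (a + d)) → P (suc a)
row-head P a H = subst P (+-comm a 1) (within-head H)

row-tail : ∀ {n} P a → Within (suc n) (λ d → P (a + d)) → Within n (λ d → P (suc a + d))
row-tail P a H d d1 dn = subst P (+-suc a d) (within-tail H d d1 dn)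

-- count g a n j = #{ b : a < b ≤ a + n , j ≤ g b }.
count : (ℕ → ℕ) → ℕ → ℕ → ℕ → ℕ
count g a zero    j = 0
count g a (suc n) j = ind j (g (suc a)) + count g (suc a) n j

count-cong : ∀ g₁ g₂ a b n j → Within n (λ d → g₁ (a + d) ≡ g₂ (b + d)) →
             count g₁ a n j ≡ count g₂ b n j
count-cong g₁ g₂ a b zero    j H = refl
count-cong g₁ g₂ a b (suc n) j H =
  cong₂ _+_ (cong (ind j) first) (count-cong g₁ g₂ (suc a) (suc b) n j rest)
  where
  first : g₁ (suc a) ≡ g₂ (suc b)
  first = trans (cong g₁ (+-comm 1 a)) (trans (within-head H) (cong g₂ (+-comm b 1)))
  rest : Within n (λ d → g₁ (suc a + d) ≡ g₂ (suc b + d))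
  rest d d1 dn = trans (cong g₁ (sym (+-suc a d))) (trans (within-tail H d d1 dn) (cong g₂ (+-suc b d)))

count-split : ∀ g a n₁ n₂ j → count g a (n₁ + n₂) j ≡ count g a n₁ j + count g (a + n₁) n₂ j
count-split g a zero     n₂ j = cong (λ b → count g b n₂ j) (sym (+-identityʳ a))
count-split g a (suc n₁) n₂ j = begin
    ind j (g (suc a)) + count g (suc a) (n₁ + n₂) j
  ≡⟨ cong (ind j (g (suc a)) +_) (count-split g (suc a) n₁ n₂ j) ⟩
    ind j (g (suc a)) + (count g (suc a) n₁ j + count g (suc a + n₁) n₂ j)
  ≡⟨ sym (+-assoc (ind j (g (suc a))) _ _) ⟩
    count g a (suc n₁) j + count g (suc a + n₁) n₂ j
  ≡⟨ cong (λ b → count g a (suc n₁) j + count g b n₂ j) (sym (+-suc a n₁)) ⟩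
    count g a (suc n₁) j + count g (a + suc n₁) n₂ j
  ∎
  where open ≡-Reasoning

count-≤ : ∀ g a n j → count g a n j ≤ n
count-≤ g a zero    j = z≤n
count-≤ g a (suc n) j = +-mono-≤ (ind-≤1 j _) (count-≤ g (suc a) n j)

count-all : ∀ g a n j → Within n (λ d → j ≤ g (a + d)) → count g a n j ≡ n
count-all g a zero    j H = refl
count-all g a (suc n) j H =
  cong₂ _+_ (ind-yes (row-head (λ b → j ≤ g b) a H))
            (count-all g (suc a) n j (row-tail (λ b → j ≤ g b) a H))

count-none : ∀ g a n j → Within n (λ d → g (a + d) < j) → count g a n j ≡ 0
count-none g a zero    j H = refl
count-none g a (suc n) j H =
  cong₂ _+_ (ind-no (row-head (λ b → g b < j) a H))
            (count-none g (suc a) n j (row-tail (λ b → g b < j) a H))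

count-anti : ∀ g a n {j j'} → j ≤ j' → count g a n j' ≤ count g a n j
count-anti g a zero    p = z≤n
count-anti g a (suc n) p = +-mono-≤ (ind-anti _ p) (count-anti g (suc a) n p)

count-mono : ∀ g a {n n'} j → n ≤ n' → count g a n j ≤ count g a n' j
count-mono g a {n} {n'} j p = begin
  count g a n j                                   ≤⟨ m≤m+n _ _ ⟩
  count g a n j + count g (a + n) (n' ∸ n) j     ≡⟨ sym (count-split g a n (n' ∸ n) j) ⟩
  count g a (n + (n' ∸ n)) j                      ≡⟨ cong (λ m → count g a m j) (m+[n∸m]≡n p) ⟩
  count g a n' j                                  ∎
  where open ≤-Reasoning

count-shift : ∀ g a n j t → count (λ b → g b + t) a n (j + t) ≡ count g a n j
count-shift g a zero    j t = refl
count-shift g a (suc n) j t = cong₂ _+_ (ind-shift j (g (suc a)) t) (count-shift g (suc a) n j t)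

Decreasing : (ℕ → ℕ) → Set
Decreasing g = ∀ a b → 1 ≤ a → a ≤ b → g b ≤ g a

count-below : ∀ g a n j d → Decreasing g → g (a + suc d) < j → count g a n j ≤ d
count-below g a n j d dec short with n ≤? d
... | yes n≤d = ≤-trans (count-≤ g a n j) n≤d
... | no  n≰d = begin
    count g a n j                                       ≡⟨ cong (λ m → count g a m j) (sym (m+[n∸m]≡n d≤n)) ⟩
    count g a (d + (n ∸ d)) j                           ≡⟨ count-split g a d (n ∸ d) j ⟩
    count g a d j + count g (a + d) (n ∸ d) j           ≡⟨ cong (count g a d j +_) (count-none g (a + d) (n ∸ d) j lower) ⟩
    count g a d j + 0                                   ≡⟨ +-identityʳ _ ⟩
    count g a d j                                       ≤⟨ count-≤ g a d j ⟩
    d                                                   ∎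
  where
  open ≤-Reasoning
  d≤n : d ≤ n
  d≤n = <⇒≤ (≰⇒> n≰d)
  lower : Within (n ∸ d) (λ e → g (a + d + e) < j)
  lower e e1 _ = ≤-<-trans (dec (a + suc d) (a + d + e) (≤-trans (s≤s z≤n) (m≤n+m (suc d) a)) below) short
    where
    below : a + suc d ≤ a + d + e
    below = subst (_≤ a + d + e) (sym (trans (+-suc a d) (+-comm 1 (a + d)))) (+-monoʳ-≤ (a + d) e1)

count-prefix : ∀ g a n j y → Decreasing g → count g a n j ≡ suc y → j ≤ g (a + suc y)
count-prefix g a n j y dec eq with j ≤? g (a + suc y)
... | yes reach = reach
... | no  short = ⊥-elim (<-irrefl refl (subst (_≤ y) eq (count-below g a n j y dec (≰⇒> short))))

part-cons : ∀ y ys i → 1 ≤ i → part (y ∷ ys) (suc i) ≡ part ys i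
part-cons y []       (suc zero)    _ = refl
part-cons y []       (suc (suc i)) _ = refl
part-cons y (x ∷ ys) (suc i)       _ = refl

part-step : ∀ xs → Linked _≥_ xs → ∀ a → 1 ≤ a → part xs (suc a) ≤ part xs a
part-step []           _       a             _ = z≤n
part-step (x ∷ [])     _       (suc a)       _ = z≤n
part-step (x ∷ y ∷ ys) (x≥y ∷ _) (suc zero)  _ = x≥y
part-step (x ∷ y ∷ ys) (_ ∷ l) (suc (suc a)) _ = part-step (y ∷ ys) l (suc a) (s≤s z≤n)

part-decreasing : ∀ xs → Linked _≥_ xs → Decreasing (part xs)
part-decreasing xs l a b a1 a≤b = go (b ∸ a) b (m+[n∸m]≡n a≤b)
  where
  go : ∀ e b → a + e ≡ b → part xs b ≤ part xs a
  go zero    b refl = ≤-reflexive (cong (part xs) (+-identityʳ a))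
  go (suc e) b refl = ≤-trans (subst (λ c → part xs c ≤ part xs (a + e)) (sym (+-suc a e))
                                (part-step xs l (a + e) (≤-trans a1 (m≤m+n a e))))
                              (go e (a + e) refl)

part-beyond : ∀ xs i → length xs < i → part xs i ≡ 0
part-beyond []       i             _       = refl
part-beyond (x ∷ xs) (suc (suc i)) (s≤s p) = part-beyond xs (suc i) p

conj-cons : ∀ x xs j → conj (x ∷ xs) j ≡ ind j x + conj xs j
conj-cons x xs j with j ≤? x
... | yes j≤x = trans (cong length (filter-accept (j ≤?_) j≤x)) (cong (_+ conj xs j) (sym (ind-yes j≤x)))
... | no  j≰x = trans (cong length (filter-reject (j ≤?_) j≰x)) (cong (_+ conj xs j) (sym (ind-no (≰⇒> j≰x))))

conj-count : ∀ xs j n → 1 ≤ j → length xs ≤ n → conj xs j ≡ count (part xs) 0 n j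
conj-count []       j n       j1 _       = sym (count-none (part []) 0 n j (λ _ _ _ → j1))
conj-count (x ∷ xs) j (suc n) j1 (s≤s p) = begin
    conj (x ∷ xs) j                         ≡⟨ conj-cons x xs j ⟩
    ind j x + conj xs j                     ≡⟨ cong (ind j x +_) (conj-count xs j n j1 p) ⟩
    ind j x + count (part xs) 0 n j         ≡⟨ cong (ind j x +_) (count-cong _ _ 0 1 n j (λ d d1 _ → sym (part-cons x xs d d1))) ⟩
    ind j x + count (part (x ∷ xs)) 1 n j   ∎
  where open ≡-Reasoning

hook-formula : ∀ xs M i j → Linked _≥_ xs → 1 ≤ i → 1 ≤ j → j ≤ part xs i → length xs ≤ i + M →
               hook xs i j ≡ (part xs i ∸ j) + count (part xs) i M j + 1
hook-formula xs M i j l i1 j1 j≤x len = begin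
    (x + conj xs j + 1) ∸ (i + j)
  ≡⟨ cong (λ c → (x + c + 1) ∸ (i + j)) (trans (conj-count xs j (i + M) j1 len) (count-split (part xs) 0 i M j)) ⟩
    (x + (count (part xs) 0 i j + leg) + 1) ∸ (i + j)
  ≡⟨ cong (λ c → (x + (c + leg) + 1) ∸ (i + j)) rows-above ⟩
    (x + (i + leg) + 1) ∸ (i + j)
  ≡⟨ cong (λ y → (y + (i + leg) + 1) ∸ (i + j)) (sym (m+[n∸m]≡n j≤x)) ⟩
    (j + (x ∸ j) + (i + leg) + 1) ∸ (i + j)
  ≡⟨ cong (_∸ (i + j)) (regroup j (x ∸ j) i leg) ⟩
    ((i + j) + ((x ∸ j) + leg + 1)) ∸ (i + j)
  ≡⟨ m+n∸m≡n (i + j) _ ⟩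
    (x ∸ j) + leg + 1
  ∎
  where
  open ≡-Reasoning
  x : ℕ
  x = part xs i
  leg : ℕ
  leg = count (part xs) i M j
  rows-above : count (part xs) 0 i j ≡ i
  rows-above = count-all (part xs) 0 i j (λ d d1 d≤i → ≤-trans j≤x (part-decreasing xs l d i d1 d≤i))
  regroup : ∀ j e i L → j + e + (i + L) + 1 ≡ (i + j) + (e + L + 1)
  regroup = solve-∀

countRow-≤ : ∀ k xs i n → countRow k xs i n ≤ n
countRow-≤ k xs i zero    = z≤n
countRow-≤ k xs i (suc n) with hook xs i (suc n) ≤? k
... | yes _ = s≤s (countRow-≤ k xs i n)
... | no  _ = m≤n⇒m≤1+n (countRow-≤ k xs i n)

countRow-upper : ∀ k xs i a n → Within n (λ j → j ≤ a → k < hook xs i j) → countRow k xs i n ≤ n ∸ a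
countRow-upper k xs i a zero    H = z≤n
countRow-upper k xs i a (suc n) H with hook xs i (suc n) ≤? k | suc n ≤? a
... | yes small | yes inside = ⊥-elim (<⇒≱ (H (suc n) (s≤s z≤n) ≤-refl inside) small)
... | yes _     | no  beyond = subst (suc (countRow k xs i n) ≤_) (sym (+-∸-assoc 1 (s≤s⁻¹ (≰⇒> beyond))))
                                 (s≤s (countRow-upper k xs i a n (λ j j1 jn → H j j1 (m≤n⇒m≤1+n jn))))
... | no  _     | _          = ≤-trans (countRow-upper k xs i a n (λ j j1 jn → H j j1 (m≤n⇒m≤1+n jn)))
                                 (∸-monoˡ-≤ a (n≤1+n n))

countRow-lower : ∀ k xs i b n → (∀ j → b < j → j ≤ n → hook xs i j ≤ k) → n ∸ b ≤ countRow k xs i n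
countRow-lower k xs i b zero    H = ≤-reflexive (0∸n≡0 b)
countRow-lower k xs i b (suc n) H with hook xs i (suc n) ≤? k | b ≤? n
... | yes _     | yes b≤n = subst (_≤ suc (countRow k xs i n)) (sym (+-∸-assoc 1 b≤n))
                              (s≤s (countRow-lower k xs i b n (λ j bj jn → H j bj (m≤n⇒m≤1+n jn))))
... | no  large | yes b≤n = ⊥-elim (large (H (suc n) (s≤s b≤n) ≤-refl))
... | _         | no  b≰n = ≤-trans (≤-reflexive (m≤n⇒m∸n≡0 (≰⇒> b≰n))) z≤n

-- RowCondition k g M i ℓ describes, through leg counts only, a row i of length g i
-- carrying exactly ℓ cells of hook ≤ k in a diagram without hooks k + 1: with
-- m = g i ∸ ℓ, the hook ℓ + leg of column m + 1 is ≤ k, and (if m ≥ 1) the hook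
-- ℓ + leg + 1 of column m exceeds k + 1.
record RowCondition (k : ℕ) (g : ℕ → ℕ) (M i ℓ : ℕ) : Set where
  field
    fits  : ℓ ≤ g i
    small : ℓ + count g i M (suc (g i ∸ ℓ)) ≤ k
    large : 0 < g i ∸ ℓ → k < ℓ + count g i M (g i ∸ ℓ)

module CoreRow (k : ℕ) (κ : List ℕ) (M i : ℕ) (core : IsCore k κ) (i1 : 1 ≤ i) (len : length κ ≤ i + M) where
  private
    x : ℕ
    x = part κ i
    ℓ : ℕ
    ℓ = pmap k κ i
    leg : ℕ → ℕ
    leg j = count (part κ) i M j

    hook-at : ∀ j → 1 ≤ j → j ≤ x → hook κ i j ≡ (x ∸ j) + leg j + 1
    hook-at j j1 j≤x = hook-formula κ M i j (proj₁ (proj₁ core)) i1 j1 j≤x len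

    hook-anti : ∀ j j' → 1 ≤ j → j ≤ j' → j' ≤ x → hook κ i j' ≤ hook κ i j
    hook-anti j j' j1 j≤j' j'≤x = subst₂ _≤_ (sym (hook-at j' (≤-trans j1 j≤j') j'≤x)) (sym (hook-at j j1 (≤-trans j≤j' j'≤x)))
      (+-monoˡ-≤ 1 (+-mono-≤ (∸-monoʳ-≤ x j≤j') (count-anti (part κ) i M j≤j')))

    fits : ℓ ≤ x
    fits = countRow-≤ k κ i x

    small-for : ∀ l → ℓ ≡ l → l + leg (suc (x ∸ l)) ≤ k
    small-for zero _ = subst (_≤ k) (sym (count-none (part κ) i M (suc x)
      (λ d _ _ → s≤s (part-decreasing κ (proj₁ (proj₁ core)) i (i + d) i1 (m≤m+n i d))))) z≤n
    small-for (suc l) eq with suc l + leg (suc (x ∸ suc l)) ≤? k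
    ... | yes ok  = ok
    ... | no  big = ⊥-elim (<-irrefl refl (subst (_≤ l) eq counted))
      where
      c : ℕ
      c = suc (x ∸ suc l)
      l<x : suc l ≤ x
      l<x = subst (_≤ x) eq fits
      c≤x : c ≤ x
      c≤x = ∸-monoʳ-< (s≤s z≤n) l<x
      x∸c : x ∸ c ≡ l
      x∸c = trans (sym (pred[m∸n]≡m∸[1+n] x (x ∸ suc l))) (cong pred (m∸[m∸n]≡n l<x))
      hook-c : hook κ i c ≡ suc l + leg c
      hook-c = trans (hook-at c (s≤s z≤n) c≤x) (trans (cong (λ a → a + leg c + 1) x∸c) (+-comm (l + leg c) 1))
      -- every column up to c has hook > k, so at most x ∸ c = l cells are counted
      counted : ℓ ≤ l
      counted = subst (ℓ ≤_) x∸c (countRow-upper k κ i c x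
        (λ j j1 j≤x j≤c → <-≤-trans (subst (k <_) (sym hook-c) (≰⇒> big)) (hook-anti j c j1 j≤c c≤x)))

    large : 0 < x ∸ ℓ → k < ℓ + leg (x ∸ ℓ)
    large m≥1 with ℓ + leg (x ∸ ℓ) ≤? k
    ... | no  big = ≰⇒> big
    ... | yes ok  = ⊥-elim (<-irrefl refl (subst (_≤ ℓ) (trans (x∸pred m≥1 (m∸n≤m x ℓ)) (cong suc (m∸[m∸n]≡n fits))) counted))
      where
      m : ℕ
      m = x ∸ ℓ
      hook-m : hook κ i m ≡ suc (ℓ + leg m)
      hook-m = trans (hook-at m m≥1 (m∸n≤m x ℓ)) (trans (cong (λ a → a + leg m + 1) (m∸[m∸n]≡n fits)) (+-comm _ 1))
      -- hook k + 1 is excluded in a core, so the hook of column m is ≤ k …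
      hook-m≤k : hook κ i m ≤ k
      hook-m≤k = s≤s⁻¹ (≤∧≢⇒< (subst (_≤ suc k) (sym hook-m) (s≤s ok)) (proj₂ core i m (i1 , m≥1 , m∸n≤m x ℓ)))
      -- … and so are all hooks further right, giving more than ℓ counted cells
      x∸pred : ∀ {m} → 1 ≤ m → m ≤ x → x ∸ (m ∸ 1) ≡ suc (x ∸ m)
      x∸pred {suc m} _ m<x = +-∸-assoc 1 m<x
      counted : x ∸ (m ∸ 1) ≤ ℓ
      counted = countRow-lower k κ i (m ∸ 1) x (λ j m≤j j≤x → ≤-trans (hook-anti m j m≥1 (after m≥1 m≤j) j≤x) hook-m≤k)
        where
        after : ∀ {m j} → 1 ≤ m → m ∸ 1 < j → m ≤ j
        after {suc m} _ p = p

  condition : RowCondition k (part κ) M i ℓ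
  condition = record { fits = fits ; small = small-for ℓ refl ; large = large }

-- A row is determined by its row condition and the rows below it: the leg counts are
-- decreasing in the column, which pins down m = g i ∸ ℓ.
row-condition-unique : ∀ k g₁ g₂ M i ℓ → RowCondition k g₁ M i ℓ → RowCondition k g₂ M i ℓ →
                       (∀ j → count g₁ i M j ≡ count g₂ i M j) → g₁ i ≡ g₂ i
row-condition-unique k g₁ g₂ M i ℓ R₁ R₂ E with <-cmp (g₁ i ∸ ℓ) (g₂ i ∸ ℓ)
... | tri≈ _ eq _ = trans (sym (m∸n+n≡m (RowCondition.fits R₁))) (trans (cong (_+ ℓ) eq) (m∸n+n≡m (RowCondition.fits R₂)))
... | tri< lt _ _ = ⊥-elim (<⇒≱ (RowCondition.large R₂ (≤-<-trans z≤n lt))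
       (≤-trans (+-monoʳ-≤ ℓ (≤-trans (count-anti g₂ i M lt) (≤-reflexive (sym (E _))))) (RowCondition.small R₁)))
... | tri> _ _ gt = ⊥-elim (<⇒≱ (RowCondition.large R₁ (≤-<-trans z≤n gt))
       (≤-trans (+-monoʳ-≤ ℓ (≤-trans (count-anti g₁ i M gt) (≤-reflexive (E _)))) (RowCondition.small R₂)))

Threshold : ℕ → ℕ → (ℕ → ℕ) → Set
Threshold t r g = Within r (λ a → t ≤ g a) × (∀ a → r < a → g a ≤ t)

record Inserted (t r n : ℕ) (g h : ℕ → ℕ) : Set where
  field
    before : Within r (λ i → h i ≡ g i)
    block  : ∀ i → r < i → i ≤ r + n → h i ≡ t
    after  : ∀ i → r + n < i → h i ≡ g (i ∸ n)

inserted-none : ∀ t r g → Inserted t r 0 g g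
inserted-none t r g = record
  { before = λ _ _ _ → refl
  ; block  = λ i r<i i≤r → ⊥-elim (<⇒≱ r<i (subst (i ≤_) (+-identityʳ r) i≤r))
  ; after  = λ _ _ → refl
  }

inserted-threshold : ∀ {t r n g h} → Threshold t r g → Inserted t r n g h → Threshold t r h
inserted-threshold {t} {r} {n} {g} {h} (above , below) I = above′ , below′
  where
  open Inserted I
  above′ : Within r (λ a → t ≤ h a)
  above′ a a1 a≤r = subst (t ≤_) (sym (before a a1 a≤r)) (above a a1 a≤r)
  below′ : ∀ a → r < a → h a ≤ t
  below′ a r<a with a ≤? r + n
  ... | yes inside = ≤-reflexive (block a r<a inside)
  ... | no  beyond = subst (_≤ t) (sym (after a (≰⇒> beyond)))
                       (below (a ∸ n) (subst (_< a ∸ n) (m+n∸n≡m r n) (∸-monoˡ-< (≰⇒> beyond) (m≤n+m n r))))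

inserted-step : ∀ {t r n g h h′} → Inserted t r n g h → Inserted t r 1 h h′ → Inserted t r (suc n) g h′
inserted-step {t} {r} {n} {g} {h} {h′} I J = record { before = before′ ; block = block′ ; after = after′ }
  where
  module I = Inserted I
  module J = Inserted J
  before′ : Within r (λ i → h′ i ≡ g i)
  before′ i i1 i≤r = trans (J.before i i1 i≤r) (I.before i i1 i≤r)
  block′ : ∀ i → r < i → i ≤ r + suc n → h′ i ≡ t
  block′ (suc i) r<i i≤ with i ≟ r
  ... | yes refl = J.block (suc r) r<i (≤-reflexive (+-comm 1 r))
  ... | no  i≢r  = trans (J.after (suc i) r+1<) (I.block i (≤∧≢⇒< (s≤s⁻¹ r<i) (λ e → i≢r (sym e)))
                                                     (s≤s⁻¹ (subst (suc i ≤_) (+-suc r n) i≤)))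
    where
    r+1< : r + 1 < suc i
    r+1< = s≤s (subst (_≤ i) (+-comm 1 r) (≤∧≢⇒< (s≤s⁻¹ r<i) (λ e → i≢r (sym e))))
  after′ : ∀ i → r + suc n < i → h′ i ≡ g (i ∸ suc n)
  after′ (suc i) r+n+1<i = begin
      h′ (suc i)          ≡⟨ J.after (suc i) (s≤s (≤-trans (≤-reflexive (+-comm r 1)) (≤-trans (s≤s (m≤m+n r n)) r+n<i))) ⟩
      h i                 ≡⟨ I.after i r+n<i ⟩
      g (i ∸ n)           ∎
    where
    open ≡-Reasoning
    r+n<i : r + n < i
    r+n<i = s≤s⁻¹ (subst (_< suc i) (+-suc r n) r+n+1<i)

ins-inserted : ∀ t ys r → 1 ≤ t → Threshold t r (part ys) → Inserted t r 1 (part ys) (part (ins t ys))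
ins-inserted t [] zero t1 _ = record { before = λ i i1 i0 → ⊥-elim (<⇒≱ i1 i0) ; block = block ; after = after }
  where
  block : ∀ i → 0 < i → i ≤ 1 → part (t ∷ []) i ≡ t
  block (suc zero) _ _ = refl
  block (suc (suc i)) _ (s≤s ())
  after : ∀ i → 1 < i → part (t ∷ []) i ≡ part [] (i ∸ 1)
  after (suc zero) (s≤s ())
  after (suc (suc i)) _ = refl
ins-inserted t [] (suc r) t1 (above , _) = ⊥-elim (<⇒≱ t1 (above 1 ≤-refl (s≤s z≤n)))
ins-inserted t (x ∷ xs) zero t1 (_ , below) with t ≤? x
... | no _ = record { before = λ i i1 i0 → ⊥-elim (<⇒≱ i1 i0) ; block = block ; after = after }
  where
  block : ∀ i → 0 < i → i ≤ 1 → part (t ∷ x ∷ xs) i ≡ t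
  block (suc zero) _ _ = refl
  block (suc (suc i)) _ (s≤s ())
  after : ∀ i → 1 < i → part (t ∷ x ∷ xs) i ≡ part (x ∷ xs) (i ∸ 1)
  after (suc zero) (s≤s ())
  after (suc (suc i)) _ = refl
... | yes t≤x = record { before = λ i i1 i0 → ⊥-elim (<⇒≱ i1 i0) ; block = block ; after = after }
  where
  -- here x = t, so t is inserted (equivalently) after the first row
  x≡t : x ≡ t
  x≡t = ≤-antisym (below 1 (s≤s z≤n)) t≤x
  module IH = Inserted (ins-inserted t xs zero t1 ((λ a a1 a0 → ⊥-elim (<⇒≱ a1 a0)) ,
                 (λ a a>0 → subst (_≤ t) (part-cons x xs a a>0) (below (suc a) (s≤s z≤n)))))
  block : ∀ i → 0 < i → i ≤ 1 → part (x ∷ ins t xs) i ≡ t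
  block (suc zero) _ _ = x≡t
  block (suc (suc i)) _ (s≤s ())
  after : ∀ i → 1 < i → part (x ∷ ins t xs) i ≡ part (x ∷ xs) (i ∸ 1)
  after (suc zero) (s≤s ())
  after (suc (suc zero))    _ = trans (IH.block 1 (s≤s z≤n) ≤-refl) (sym x≡t)
  after (suc (suc (suc i))) _ = IH.after (suc (suc i)) (s≤s (s≤s z≤n))
ins-inserted t (x ∷ xs) (suc r) t1 (above , below) with t ≤? x
... | no t≰x = ⊥-elim (t≰x (above 1 (s≤s z≤n) (s≤s z≤n)))
... | yes _  = record { before = before ; block = block ; after = after }
  where
  module IH = Inserted (ins-inserted t xs r t1
    ((λ a a1 a≤r → subst (t ≤_) (part-cons x xs a a1) (above (suc a) (s≤s z≤n) (s≤s a≤r))) ,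
     (λ a r<a → subst (_≤ t) (part-cons x xs a (≤-trans (s≤s z≤n) r<a)) (below (suc a) (s≤s r<a)))))
  before : Within (suc r) (λ i → part (x ∷ ins t xs) i ≡ part (x ∷ xs) i)
  before (suc zero)    _ _         = refl
  before (suc (suc i)) _ (s≤s i≤r) = IH.before (suc i) (s≤s z≤n) i≤r
  block : ∀ i → suc r < i → i ≤ suc r + 1 → part (x ∷ ins t xs) i ≡ t
  block (suc (suc i)) (s≤s r<i) (s≤s i≤) = IH.block (suc i) r<i i≤
  after : ∀ i → suc r + 1 < i → part (x ∷ ins t xs) i ≡ part (x ∷ xs) (i ∸ 1)
  after (suc (suc i)) (s≤s r+1<i) =
    trans (IH.after (suc i) r+1<i) (sym (part-cons x xs i (≤-trans (m≤n+m 1 r) (s≤s⁻¹ r+1<i))))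

union-inserted : ∀ t r la n → 1 ≤ t → Threshold t r (part la) →
                 Inserted t r n (part la) (part (union la (replicate n t)))
union-inserted t r la zero    t1 th = inserted-none t r (part la)
union-inserted t r la (suc n) t1 th =
  inserted-step I (ins-inserted t (union la (replicate n t)) r t1 (inserted-threshold th I))
  where
  I : Inserted t r n (part la) (part (union la (replicate n t)))
  I = union-inserted t r la n t1 th

row-condition-at : ∀ {k M} h i ℓ x → h i ≡ x → ℓ ≤ x → ℓ + count h i M (suc (x ∸ ℓ)) ≤ k →
                   (0 < x ∸ ℓ → k < ℓ + count h i M (x ∸ ℓ)) → RowCondition k h M i ℓ
row-condition-at h i ℓ x refl fits small large = record { fits = fits ; small = small ; large = large }

row-condition-transfer : ∀ {k M} g₁ g₂ i₁ i₂ ℓ → RowCondition k g₁ M i₁ ℓ → g₂ i₂ ≡ g₁ i₁ →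
                         (∀ j → count g₂ i₂ M j ≡ count g₁ i₁ M j) → RowCondition k g₂ M i₂ ℓ
row-condition-transfer {k} g₁ g₂ i₁ i₂ ℓ R e E = row-condition-at g₂ i₂ ℓ (g₁ i₁) e fits
  (subst (λ c → ℓ + c ≤ k) (sym (E _)) small)
  (λ pos → subst (λ c → k < ℓ + c) (sym (E _)) (large pos))
  where open RowCondition R

-- Two diagrams satisfying the same row conditions and agreeing beyond row N coincide:
-- going upwards from row N, each row is determined by the rows below it.
rows-determine : ∀ k M (G f ℓ : ℕ → ℕ) N →
                 (∀ i → 1 ≤ i → RowCondition k G M i (ℓ i)) → (∀ i → 1 ≤ i → RowCondition k f M i (ℓ i)) →
                 (∀ i → N < i → G i ≡ f i) → ∀ i → 1 ≤ i → G i ≡ f i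
rows-determine k M G f ℓ N RG Rf far i i1 = upward (suc N) i i1 (m≤n+m (suc N) i)
  where
  upward : ∀ n i → 1 ≤ i → N < i + n → G i ≡ f i
  upward zero    i i1 N<i = far i (subst (N <_) (+-identityʳ i) N<i)
  upward (suc n) i i1 N<  = row-condition-unique k G f M i (ℓ i) (RG i i1) (Rf i i1)
    (λ j → count-cong G f i i M j (λ d d1 _ → upward n (i + d) (≤-trans i1 (m≤m+n i d))
      (≤-trans N< (≤-trans (≤-reflexive (+-suc i n)) (+-monoˡ-≤ n (m<m+n i d1))))))

module ShiftedCore (k t r K M : ℕ) (g lam : ℕ → ℕ)
  (t+K : t + K ≡ suc k) (K≥1 : 1 ≤ K) (r+K≤M : r + K ≤ M) (dec : Decreasing g)
  (rows : ∀ i → 1 ≤ i → RowCondition k g M i (lam i)) (th : Threshold t r lam) where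

  f : ℕ → ℕ
  f i with i ≤? r + K
  ... | yes _ = g i + t
  ... | no  _ = g (i ∸ K)

  f-band : ∀ i → i ≤ r + K → f i ≡ g i + t
  f-band i i≤ with i ≤? r + K
  ... | yes _ = refl
  ... | no  i≰ = ⊥-elim (i≰ i≤)

  f-tail : ∀ i → r + K < i → f i ≡ g (i ∸ K)
  f-tail i r+K<i with i ≤? r + K
  ... | yes i≤ = ⊥-elim (<⇒≱ r+K<i i≤)
  ... | no  _  = refl

  f-tail′ : ∀ d → 1 ≤ d → f (r + K + d) ≡ g (r + d)
  f-tail′ d d1 = trans (f-tail (r + K + d) (m<m+n (r + K) d1)) (cong g (trans (cong (_∸ K) (swap r K d)) (m+n∸n≡m (r + d) K)))
    where
    swap : ∀ r K d → r + K + d ≡ r + d + K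
    swap = solve-∀

  -- Below row r the rows of g drop by at most t within K steps, unless they are ≤ t:
  -- otherwise the long hook (> k + 1) at the end of the non-counted part of row i
  -- would need K legs, while fewer than K rows below i reach column g i ∸ t.
  close : ∀ i → r < i → t < g i → Within K (λ d → g i ≤ g (i + d) + t)
  close i r<i t<gi (suc d) _ d<K with g i ≤? g (i + suc d) + t
  ... | yes ok   = ok
  ... | no  drop = ⊥-elim (<⇒≱ d<K (≤-trans K≤legs legs≤d))
    where
    ℓ : ℕ
    ℓ = lam i
    ℓ≤t : ℓ ≤ t
    ℓ≤t = proj₂ th i r<i
    open RowCondition (rows i (≤-trans (s≤s z≤n) r<i))
    K≤legs : K ≤ count g i M (g i ∸ t)
    K≤legs = +-cancelˡ-≤ t K _ (begin
      t + K                          ≡⟨ t+K ⟩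
      suc k                          ≤⟨ large (m<n⇒0<n∸m (≤-<-trans ℓ≤t t<gi)) ⟩
      ℓ + count g i M (g i ∸ ℓ)      ≤⟨ +-mono-≤ ℓ≤t (count-anti g i M (∸-monoʳ-≤ (g i) ℓ≤t)) ⟩
      t + count g i M (g i ∸ t)      ∎)
      where open ≤-Reasoning
    legs≤d : count g i M (g i ∸ t) ≤ d
    legs≤d = count-below g i M (g i ∸ t) d dec (m+n≤o⇒m≤o∸n (suc (g (i + suc d))) (≰⇒> drop))

  legs-shift : ∀ N c → 1 ≤ c → count g r N (c + t) ≤ count g (r + K) N c
  legs-shift N c c1 with count g r N (c + t) in eq
  ... | zero  = z≤n
  ... | suc y = begin
      suc y                        ≡⟨ sym (count-all g (r + K) (suc y) c shifted) ⟩
      count g (r + K) (suc y) c    ≤⟨ count-mono g (r + K) c (subst (_≤ N) eq (count-≤ g r N (c + t))) ⟩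
      count g (r + K) N c          ∎
    where
    open ≤-Reasoning
    shifted : Within (suc y) (λ d → c ≤ g (r + K + d))
    shifted d d1 d≤y = +-cancelʳ-≤ t c _ (subst (λ b → c + t ≤ g b + t) (swap r d K) (≤-trans reach
      (close (r + d) (m<m+n r d1) (<-≤-trans (m<n+m t c1) reach) K K≥1 ≤-refl)))
      where
      reach : c + t ≤ g (r + d)
      reach = ≤-trans (count-prefix g r N (c + t) y dec eq)
                      (dec (r + d) (r + suc y) (≤-trans d1 (m≤n+m d r)) (+-monoʳ-≤ r d≤y))
      swap : ∀ r d K → r + d + K ≡ r + K + d
      swap = solve-∀

  module Below (i : ℕ) (i≤ : i ≤ r + K) where
    a : ℕ
    a = r + K ∸ i
    M₃ : ℕ
    M₃ = M ∸ a

    i+a : i + a ≡ r + K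
    i+a = m+[n∸m]≡n i≤

    a+M₃ : a + M₃ ≡ M
    a+M₃ = m+[n∸m]≡n (≤-trans (m∸n≤m (r + K) i) r+K≤M)

    f-legs : ∀ j → count f i M j ≡ count f i a j + count g r M₃ j
    f-legs j = begin
        count f i M j                           ≡⟨ cong (λ n → count f i n j) (sym a+M₃) ⟩
        count f i (a + M₃) j                    ≡⟨ count-split f i a M₃ j ⟩
        count f i a j + count f (i + a) M₃ j    ≡⟨ cong (count f i a j +_) (count-cong f g (i + a) r M₃ j tail) ⟩
        count f i a j + count g r M₃ j          ∎
      where
      open ≡-Reasoning
      tail : Within M₃ (λ d → f (i + a + d) ≡ g (r + d))
      tail d d1 _ = trans (cong (λ b → f (b + d)) i+a) (f-tail′ d d1)

    band-legs : ∀ c → count f i a (c + t) ≡ count g i a c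
    band-legs c = trans (count-cong f (λ b → g b + t) i i a (c + t)
                          (λ d _ d≤a → f-band (i + d) (subst (i + d ≤_) i+a (+-monoʳ-≤ i d≤a))))
                        (count-shift g i a c t)

    g-legs : ∀ c → count g i M c ≡ count g i a c + count g (r + K) M₃ c
    g-legs c = begin
        count g i M c                           ≡⟨ cong (λ n → count g i n c) (sym a+M₃) ⟩
        count g i (a + M₃) c                    ≡⟨ count-split g i a M₃ c ⟩
        count g i a c + count g (i + a) M₃ c    ≡⟨ cong (λ b → count g i a c + count g b M₃ c) i+a ⟩
        count g i a c + count g (r + K) M₃ c    ∎
      where open ≡-Reasoning

    band≤f-legs : ∀ c → count g i a c ≤ count f i M (c + t)
    band≤f-legs c = subst (_≤ count f i M (c + t)) (band-legs c)
      (subst (count f i a (c + t) ≤_) (sym (f-legs (c + t))) (m≤m+n _ _))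

    f-legs≤g-legs : ∀ c → 1 ≤ c → count f i M (c + t) ≤ count g i M c
    f-legs≤g-legs c c1 = begin
      count f i M (c + t)                           ≡⟨ f-legs (c + t) ⟩
      count f i a (c + t) + count g r M₃ (c + t)    ≡⟨ cong (_+ count g r M₃ (c + t)) (band-legs c) ⟩
      count g i a c + count g r M₃ (c + t)          ≤⟨ +-monoʳ-≤ (count g i a c) (legs-shift M₃ c c1) ⟩
      count g i a c + count g (r + K) M₃ c          ≡⟨ sym (g-legs c) ⟩
      count g i M c                                 ∎
      where open ≤-Reasoning

  tail-row : ∀ i → r + K < i → RowCondition k f M i (lam (i ∸ K))
  tail-row i r+K<i = row-condition-transfer g f (i ∸ K) i (lam (i ∸ K)) (rows (i ∸ K) i∸K≥1) (f-tail i r+K<i)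
    (λ j → count-cong f g i (i ∸ K) M j (λ d _ _ → trans (f-tail (i + d) (≤-trans r+K<i (m≤m+n i d))) (cong g (+-∸-comm d K≤i))))
    where
    K≤i : K ≤ i
    K≤i = ≤-trans (m≤n+m K r) (<⇒≤ r+K<i)
    i∸K≥1 : 1 ≤ i ∸ K
    i∸K≥1 = m+n≤o⇒m≤o∸n 1 (≤-trans (s≤s (m≤n+m K r)) r+K<i)

  -- Band rows r < i ≤ r + K of f carry t counted cells: writing i = r + (p + 1), the legs
  -- of columns g i + 1 and g i come from the a = r + K ∸ i band rows and the p + 1 rows
  -- r + 1, …, i of g, and a + p + 1 = K.
  band-row : ∀ i → r < i → i ≤ r + K → RowCondition k f M i t
  band-row i r<i i≤ = row-condition-at f i t (g i + t) (f-band i i≤) (m≤n+m t (g i))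
    (subst (λ m → t + count f i M (suc m) ≤ k) (sym (m+n∸n≡m (g i) t)) small)
    (λ pos → subst (λ m → k < t + count f i M m) (sym (m+n∸n≡m (g i) t)) (large (subst (0 <_) (m+n∸n≡m (g i) t) pos)))
    where
    open Below i i≤
    p : ℕ
    p = i ∸ suc r
    r+p+1 : r + suc p ≡ i
    r+p+1 = trans (+-suc r p) (m+[n∸m]≡n r<i)
    K-eq : suc p + a ≡ K
    K-eq = +-cancelˡ-≡ r _ _ (trans (sym (+-assoc r (suc p) a)) (trans (cong (_+ a) r+p+1) i+a))
    budget : t + (a + suc p) ≡ suc k
    budget = trans (cong (t +_) (trans (+-comm a (suc p)) K-eq)) t+K
    small : t + count f i M (suc (g i)) ≤ k
    small = s≤s⁻¹ (begin-strict
      t + count f i M (suc (g i))                              ≡⟨ cong (t +_) (f-legs (suc (g i))) ⟩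
      t + (count f i a (suc (g i)) + count g r M₃ (suc (g i))) ≤⟨ +-monoʳ-≤ t (+-mono-≤ (count-≤ f i a _) below-i) ⟩
      t + (a + p)                                              <⟨ +-monoʳ-< t (+-monoʳ-< a ≤-refl) ⟩
      t + (a + suc p)                                          ≡⟨ budget ⟩
      suc k                                                    ∎)
      where
      open ≤-Reasoning
      below-i : count g r M₃ (suc (g i)) ≤ p
      below-i = count-below g r M₃ (suc (g i)) p dec (s≤s (≤-reflexive (cong g r+p+1)))
    large : 0 < g i → k < t + count f i M (g i)
    large _ = begin-strict
      k                                                        <⟨ ≤-refl ⟩
      suc k                                                    ≡⟨ sym budget ⟩
      t + (a + suc p)                                          ≤⟨ +-monoʳ-≤ t (+-mono-≤ (≤-reflexive (sym band-full)) above-i) ⟩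
      t + (count f i a (g i) + count g r M₃ (g i))             ≡⟨ cong (t +_) (sym (f-legs (g i))) ⟩
      t + count f i M (g i)                                    ∎
      where
      open ≤-Reasoning
      -- the band rows below i reach column g i: trivially if g i ≤ t, else by 'close'
      band-full : count f i a (g i) ≡ a
      band-full = count-all f i a (g i) (λ d d1 d≤a → subst (g i ≤_) (sym (f-band (i + d) (subst (i + d ≤_) i+a (+-monoʳ-≤ i d≤a))))
        (lengthened d d1 d≤a))
        where
        lengthened : ∀ d → 1 ≤ d → d ≤ a → g i ≤ g (i + d) + t
        lengthened d d1 d≤a with g i ≤? t
        ... | yes gi≤t = ≤-trans gi≤t (m≤n+m t _)
        ... | no  gi≰t = close i r<i (≰⇒> gi≰t) d d1 (≤-trans d≤a (subst (a ≤_) K-eq (m≤n+m a (suc p))))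
      above-i : suc p ≤ count g r M₃ (g i)
      above-i = subst (_≤ count g r M₃ (g i))
        (count-all g r (suc p) (g i) (λ d d1 d≤p → dec (r + d) i (≤-trans d1 (m≤n+m d r)) (subst (r + d ≤_) r+p+1 (+-monoʳ-≤ r d≤p))))
        (count-mono g r (g i) (m+n≤o⇒m≤o∸n (suc p) (subst (_≤ M) (sym K-eq) (≤-trans (m≤n+m K r) r+K≤M))))

  -- Top rows i ≤ r of f keep their value lam i: the non-counted part grows by t.
  top-row : ∀ i → 1 ≤ i → i ≤ r → RowCondition k f M i (lam i)
  top-row i i1 i≤r = row-condition-at f i (lam i) (g i + t) (f-band i i≤) (≤-trans R.fits (m≤m+n (g i) t))
    (subst (λ c → lam i + count f i M (suc c) ≤ k) (sym shift-m) small)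
    (λ pos → subst (λ c → k < lam i + count f i M c) (sym shift-m) (large (subst (0 <_) shift-m pos)))
    where
    i≤ : i ≤ r + K
    i≤ = ≤-trans i≤r (m≤m+n r K)
    open Below i i≤
    module R = RowCondition (rows i i1)
    m : ℕ
    m = g i ∸ lam i
    shift-m : g i + t ∸ lam i ≡ m + t
    shift-m = +-∸-comm t R.fits
    small : lam i + count f i M (suc m + t) ≤ k
    small = ≤-trans (+-monoʳ-≤ (lam i) (f-legs≤g-legs (suc m) (s≤s z≤n))) R.small
    large : 0 < m + t → k < lam i + count f i M (m + t)
    large _ with m ≤? g (r + K)
    -- all K band rows after row r reach column m, giving at least t + K = k + 1
    ... | yes m≤ = begin-strict
        k                                 <⟨ ≤-refl ⟩
        suc k                             ≡⟨ sym t+K ⟩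
        t + K                             ≤⟨ +-mono-≤ (proj₁ th i i1 i≤r) (subst (K ≤_) (sym band-full) K≤a) ⟩
        lam i + count g i a m             ≤⟨ +-monoʳ-≤ (lam i) (band≤f-legs m) ⟩
        lam i + count f i M (m + t)       ∎
      where
      open ≤-Reasoning
      band-full : count g i a m ≡ a
      band-full = count-all g i a m (λ d d1 d≤a → ≤-trans m≤ (dec (i + d) (r + K) (≤-trans i1 (m≤m+n i d))
                    (subst (i + d ≤_) i+a (+-monoʳ-≤ i d≤a))))
      K≤a : K ≤ a
      K≤a = m+n≤o⇒m≤o∸n K (subst (_≤ r + K) (+-comm i K) (+-monoˡ-≤ K i≤r))
    -- no row after r + K reaches column m, so the legs of g at m are all legs of f at m + t
    ... | no  m≰ = begin-strict
        k                                                     <⟨ R.large (≤-<-trans z≤n (≰⇒> m≰)) ⟩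
        lam i + count g i M m                                 ≡⟨ cong (lam i +_) (g-legs m) ⟩
        lam i + (count g i a m + count g (r + K) M₃ m)        ≡⟨ cong (λ c → lam i + (count g i a m + c)) none ⟩
        lam i + (count g i a m + 0)                           ≡⟨ cong (lam i +_) (+-identityʳ _) ⟩
        lam i + count g i a m                                 ≤⟨ +-monoʳ-≤ (lam i) (band≤f-legs m) ⟩
        lam i + count f i M (m + t)                           ∎
      where
      open ≤-Reasoning
      none : count g (r + K) M₃ m ≡ 0
      none = count-none g (r + K) M₃ m (λ d _ _ → ≤-<-trans
               (dec (r + K) (r + K + d) (≤-trans K≥1 (m≤n+m K r)) (m≤m+n (r + K) d)) (≰⇒> m≰))

  shifted-rows : (lamT : ℕ → ℕ) → Inserted t r K lam lamT → ∀ i → 1 ≤ i → RowCondition k f M i (lamT i)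
  shifted-rows lamT I i i1 with i ≤? r | i ≤? r + K
  ... | yes i≤r | _      = subst (RowCondition k f M i) (sym (Inserted.before I i i1 i≤r)) (top-row i i1 i≤r)
  ... | no  i≰r | yes i≤ = subst (RowCondition k f M i) (sym (Inserted.block I i (≰⇒> i≰r) i≤)) (band-row i (≰⇒> i≰r) i≤)
  ... | no  _   | no  i≰ = subst (RowCondition k f M i) (sym (Inserted.after I i (≰⇒> i≰))) (tail-row i (≰⇒> i≰))

  shifted-core : (G lamT : ℕ → ℕ) → Inserted t r K lam lamT → (∀ i → 1 ≤ i → RowCondition k G M i (lamT i)) →
                 ∀ Lg → (∀ b → Lg < b → g b ≡ 0) → ∀ LG → (∀ b → LG < b → G b ≡ 0) →
                 ∀ i → 1 ≤ i → (i ≤ r + K → G i ≡ g i + t) × (r + K < i → G i ≡ g (i ∸ K))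
  shifted-core G lamT I RG Lg g0 LG G0 i i1 = (λ i≤ → trans G≡f (f-band i i≤)) , (λ r+K<i → trans G≡f (f-tail i r+K<i))
    where
    N : ℕ
    N = LG + (Lg + (r + K))
    vanish : ∀ b → N < b → G b ≡ f b
    vanish b N<b = trans (G0 b (≤-<-trans (m≤m+n LG _) N<b))
      (sym (trans (f-tail b (≤-<-trans (≤-trans (m≤n+m (r + K) Lg) (m≤n+m _ LG)) N<b))
                  (g0 (b ∸ K) (m+n≤o⇒m≤o∸n (suc Lg) (≤-trans (s≤s (≤-trans (+-monoʳ-≤ Lg (m≤n+m K r)) (m≤n+m _ LG))) N<b)))))
    G≡f : G i ≡ f i
    G≡f = rows-determine k M G f lamT N RG (shifted-rows lamT I) vanish i i1

core-rows : ∀ k κ la M → IsCoreOf k κ la → length κ ≤ M → ∀ i → 1 ≤ i → RowCondition k (part κ) M i (part la i)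
core-rows k κ la M (core , 𝔭κ≡λ) len i i1 = subst (RowCondition k (part κ) M i) (𝔭κ≡λ i i1)
  (CoreRow.condition k κ M i core i1 (≤-trans len (m≤n+m M i)))

partition-threshold : ∀ la t r → Linked _≥_ la → (r ≡ 0 ⊎ t ≤ part la r) → part la (suc r) ≤ t → Threshold t r (part la)
partition-threshold la t r l λr≥t λr+1≤t = above , below
  where
  above : Within r (λ a → t ≤ part la a)
  above a a1 a≤r = from λr≥t
    where
    from : (r ≡ 0 ⊎ t ≤ part la r) → t ≤ part la a
    from (inj₁ refl) = ⊥-elim (<⇒≱ a1 a≤r)
    from (inj₂ t≤λr) = ≤-trans t≤λr (part-decreasing la l a r a1 a≤r)
  below : ∀ a → r < a → part la a ≤ t
  below a r<a = ≤-trans (part-decreasing la l (suc r) a (s≤s z≤n) r<a) λr+1≤t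

lemma2p13 : (k : ℕ) → 1 ≤ k →
    (la : List ℕ) → IsPartition la → Bounded k la →
    (t : ℕ) → 1 ≤ t → t ≤ k →
    (r : ℕ) → (r ≡ 0 ⊎ t ≤ part la r) → part la (suc r) ≤ t →
    (κ κ~ : List ℕ) → IsCoreOf k κ la → IsCoreOf k κ~ (union la (R k t)) →
    (i : ℕ) → 1 ≤ i →
      (i ≤ r + (suc k ∸ t) → part κ~ i ≡ part κ i + t)
      × (suc r + (suc k ∸ t) ≤ i → part κ~ i ≡ part κ (i ∸ (suc k ∸ t)))
lemma2p13 k _ la (λ-decr , _) _ t t≥1 t≤k r λr≥t λr+1≤t κ κ~ κ-core κ~-core =
  ShiftedCore.shifted-core k t r K M (part κ) (part la) t+K K≥1 (m≤n+m (r + K) (length κ + length κ~))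
    (part-decreasing κ (proj₁ (proj₁ (proj₁ κ-core))))
    (core-rows k κ la M κ-core (≤-trans (m≤m+n _ _) (m≤m+n _ (r + K)))) th
    (part κ~) (part (union la (R k t))) (union-inserted t r la K t≥1 th)
    (core-rows k κ~ (union la (R k t)) M κ~-core (≤-trans (m≤n+m _ (length κ)) (m≤m+n _ (r + K))))
    (length κ) (part-beyond κ) (length κ~) (part-beyond κ~)
  where
  K : ℕ
  K = suc k ∸ t
  -- enough rows to see every leg of κ and κ~, and the whole band
  M : ℕ
  M = length κ + length κ~ + (r + K)
  t+K : t + K ≡ suc k
  t+K = m+[n∸m]≡n (m≤n⇒m≤1+n t≤k)
  K≥1 : 1 ≤ K
  K≥1 = m+n≤o⇒m≤o∸n 1 (s≤s t≤k)
  th : Threshold t r (part la)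
  th = partition-threshold la t r λ-decr λr≥t λr+1≤t
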